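{- Let $n\ge1$. Suppose $|\mathcal{F}(n-1)|=r'$, $|\mathcal{F}(n)|=r$, $\beta(n-1)$ has $s'$ ones and $\beta(n)$ has $s$ ones. Then $$\mathrm{CW}_q(n)=q^{r'-r+s'-s}\,\frac{\mathrm{rgf}_{n-1}(q^{ -1})}{\mathrm{rgf}_n(q^{ -1})}.$$
   Context: $h_q(N)=\sum_\eta q^{\ell(\eta)}$ over hyperbinary partitions $\eta$ of $N$ (partitions into powers of $2$, each part used at most twice), $\ell(\eta)$ = number of parts; $h_q(0)=1$. $\mathrm{CW}_q(n)=h_q(n-1)/h_q(n)$ for $n\ge1$. $\beta(N)=b_1\cdots b_k$ is the binary expansion of $N$, most significant digit first ($\beta(0)$ empty). Its principal prefix is $b_1\cdots b_\rho$ where $b_{\rho+1}$ is the rightmost $0$ of $\beta(N)$ ($\rho=0$ if none). The fence $\mathcal{F}(N)$ is the poset on $\{x_1,\dots,x_\rho\}$ with covers, for $2\le i\le\rho$: $x_i$ covered by $x_{i-1}$ if $b_i=0$, and $x_i$ covers $x_{i-1}$ if $b_i=1$. $\mathrm{rgf}_N(t)=\sum_I t^{|I|}$ over all lower order ideals $I$ of $\mathcal{F}(N)$. -}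

module Defs where

open import Data.Nat as ℕ using (ℕ; zero; suc; _+_)
open import Data.Nat.DivMod using (_/_; _%_)
open import Data.Integer as ℤ using (ℤ; +_; -[1+_])
open import Data.Rational as ℚ using (ℚ; 0ℚ; 1ℚ; _*_; 1/_)
open import Data.Rational.Properties using (_≟_)
open import Data.Bool using (Bool; true; false; not; _∧_; _∨_; if_then_else_)
open import Data.List using (List; []; _∷_; map; filter; reverse; length; concatMap; foldr)
open import Data.Fin using (Fin; zero; suc; toℕ)
open import Data.Vec as Vec using (Vec; []; _∷_)
open import Data.Product using (_×_; _,_)
open import Relation.Nullary using (yes; no)
open import Relation.Nullary.Decidable using (does)
open import Relation.Binary.PropositionalEquality using (_≡_)

sumℚ : List ℚ → ℚ
sumℚ = foldr ℚ._+_ 0ℚ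

_^ℕ_ : ℚ → ℕ → ℚ
q ^ℕ zero  = 1ℚ
q ^ℕ suc k = q * (q ^ℕ k)

-- total multiplicative inverse (inv 0 = 0); only ever applied to
-- nonzero values in the statement (q > 0)
inv : ℚ → ℚ
inv q with q ≟ 0ℚ
... | yes _ = 0ℚ
... | no q≢0 = 1/_ q {{ℚ.≢-nonZero q≢0}}

_^ℤ_ : ℚ → ℤ → ℚ
q ^ℤ (+ k)     = q ^ℕ k
q ^ℤ -[1+ k ]  = (inv q) ^ℕ (suc k)

_÷'_ : ℚ → ℚ → ℚ
a ÷' b = a * inv b

allVecs : (k : ℕ) → List (Vec (Fin 3) k)
allVecs zero    = [] ∷ []
allVecs (suc k) = concatMap (λ v → map (λ d → d Vec.∷ v) (zero ∷ suc zero ∷ suc (suc zero) ∷ [])) (allVecs k)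

-- A hyperbinary partition of N is recorded by its multiplicity vector
-- (m_0, …, m_N), m_i ∈ {0,1,2} = multiplicity of the part 2^i.
-- (Every part of a partition of N is ≤ N < 2^(N+1), so parts 2^0..2^N suffice.)
-- value Σ m_i 2^i
weight : ∀ {k} → Vec (Fin 3) k → ℕ
weight []      = 0
weight (m ∷ v) = toℕ m + 2 ℕ.* weight v

numParts : ∀ {k} → Vec (Fin 3) k → ℕ
numParts []      = 0
numParts (m ∷ v) = toℕ m + numParts v


HB : (N : ℕ) → List (Vec (Fin 3) (suc N))
HB N = filter (λ v → weight v ℕ.≟ N) (allVecs (suc N))

hq : ℚ → ℕ → ℚ
hq q N = sumℚ (map (λ v → q ^ℕ numParts v) (HB N))

CW : ℚ → ℕ → ℚ
CW q n = hq q (n ℕ.∸ 1) ÷' hq q n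

-- least-significant-digit-first binary digits (fuel = N suffices)
lsbDigits : ℕ → ℕ → List Bool
lsbDigits zero     _ = []
lsbDigits (suc f)  zero = []
lsbDigits (suc f)  (suc m) = does ((suc m % 2) ℕ.≟ 1) ∷ lsbDigits f (suc m / 2)

-- β(N) = b_1 ⋯ b_k, most significant digit first (true = 1, false = 0)
β : ℕ → List Bool
β N = reverse (lsbDigits N N)

ones : List Bool → ℕ
ones []          = 0
ones (true ∷ bs) = suc (ones bs)
ones (false ∷ bs) = ones bs

afterFirstZero : List Bool → List Bool
afterFirstZero []           = []
afterFirstZero (true ∷ bs)  = afterFirstZero bs
afterFirstZero (false ∷ bs) = bs

-- principal prefix b_1 ⋯ b_ρ of β(N), where b_{ρ+1} is the rightmost 0
-- of β(N) (empty if β(N) has no 0)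
principalPrefix : ℕ → List Bool
principalPrefix N = reverse (afterFirstZero (reverse (β N)))

fenceSize : ℕ → ℕ
fenceSize N = length (principalPrefix N)

-- A subset of {x_1,…,x_ρ} is a list a_1 ⋯ a_ρ of membership booleans.
-- Cover condition between x_{i-1} (membership a) and x_i (membership a'),
-- with digit b_i:
--   b_i = 0 : x_i ⋖ x_{i-1}, so x_{i-1} ∈ I ⇒ x_i ∈ I
--   b_i = 1 : x_{i-1} ⋖ x_i, so x_i ∈ I ⇒ x_{i-1} ∈ I
coverOK : Bool → Bool → Bool → Bool
coverOK false a a' = not a ∨ a'
coverOK true  a a' = not a' ∨ a

-- I is a lower order ideal iff it is closed downward along every cover
-- relation x_i vs x_{i-1}, 2 ≤ i ≤ ρ (the order is generated by these covers)
isLowerIdeal : List Bool → List Bool → Bool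
isLowerIdeal (b₁ ∷ b₂ ∷ bs) (a₁ ∷ a₂ ∷ as) = coverOK b₂ a₁ a₂ ∧ isLowerIdeal (b₂ ∷ bs) (a₂ ∷ as)
isLowerIdeal _ _ = true

subsets : ℕ → List (List Bool)
subsets zero    = [] ∷ []
subsets (suc k) = concatMap (λ s → (true ∷ s) ∷ (false ∷ s) ∷ []) (subsets k)

lowerIdeals : ℕ → List (List Bool)
lowerIdeals N = filter (λ I → isLowerIdeal (principalPrefix N) I ≡? true) (subsets (fenceSize N))
  where
  open import Data.Bool.Properties renaming (_≟_ to _≡?_)

rgf : ℕ → ℚ → ℚ
rgf N t = sumℚ (map (λ I → t ^ℕ ones I) (lowerIdeals N))

-- Both h_q(N) and q^(ρ+s) rgf_N(1/q) obey one recursion in the last binary digit of N.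
-- Splitting off the parts equal to 1 gives h(2m+1) = q h(m) and h(2m+2) = h(m+1) + q² h(m).
-- Appending a digit to a word w adds a new top element to the fence, below the old top for
-- the digit 0 and above it for the digit 1, so the lower ideals of the longer fence, sorted by
-- whether they contain the new top, arise from those of w through a 2×2 transfer matrix.
-- Weighting an ideal I of 𝓕(w) by q^(ones w + |𝓕(w) ∖ I|), the two sorted sums for w = β N
-- are h(N) and q² h(N−1). Since the principal prefix of 2m+1 is that of m and the one of
-- 2m+2 is β(m+1), this yields h(N) = q^(ρ+s) rgf_N(1/q), and CW_q(n) is a quotient of two
-- instances.

module Submission where

open import Defs

module HyperbinaryFences where
  open import Data.Bool using (Bool; true; false; not; _∧_)
  import Data.Bool.Properties as Bool
  open import Data.List using (List; []; _∷_; _++_; [_]; _∷ʳ_; map; filter; concatMap; length; reverse)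
  import Data.List.Properties as List
  open import Data.Nat.DivMod using (_/_; _%_; m/n<m; m*n/n≡m; m*n%n≡0; [m+kn]%n≡m%n; +-distrib-/-∣ʳ)
  open import Data.Nat.Divisibility using (divides-refl)
  open import Data.Integer as ℤ using (_⊖_)
  import Data.Integer.Properties as ℤ
  open import Data.Nat as ℕ using (ℕ; zero; suc; _∸_; _≤_; _<_; _≤′_; z<s; s≤s; ≤′-refl; ≤′-step)
  import Data.Nat.Properties as ℕ
  open import Data.Rational as ℚ using (ℚ; 0ℚ; 1ℚ; _+_; _*_)
  import Data.Rational.Properties as ℚ
  open import Function using (_∘_; mk⇔)
  open import Level using (0ℓ)
  open import Relation.Nullary using (¬_; Dec; yes; no; contradiction)
  open import Relation.Nullary.Decidable using (does; does-⇔; dec-false; dec⇒maybe)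
  open import Relation.Unary using (Pred; Decidable)
  open import Relation.Binary.PropositionalEquality
    using (_≡_; _≢_; refl; sym; trans; cong; cong₂; subst; module ≡-Reasoning)
  open import Tactic.RingSolver using (solve-∀)
  import Tactic.RingSolver.Core.AlmostCommutativeRing as ACR

  ℚ-ring : ACR.AlmostCommutativeRing 0ℓ 0ℓ
  ℚ-ring = ACR.fromCommutativeRing ℚ.+-*-commutativeRing (λ x → dec⇒maybe (0ℚ ℚ.≟ x))

  infixl 7 _when_

  _when_ : ℚ → Bool → ℚ
  x when true  = x
  x when false = 0ℚ

  *-when : ∀ c x b → (c * x) when b ≡ c * (x when b)
  *-when c x true  = refl
  *-when c x false = sym (ℚ.*-zeroʳ c)

  when-⇔ : ∀ {P Q : Set} (P? : Dec P) (Q? : Dec Q) x → (P → Q) → (Q → P) →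
           x when does P? ≡ x when does Q?
  when-⇔ P? Q? x to from = cong (x when_) (does-⇔ (mk⇔ to from) P? Q?)

  when-¬ : ∀ {P : Set} (P? : Dec P) x → ¬ P → x when does P? ≡ 0ℚ
  when-¬ P? x ¬p = cong (x when_) (dec-false P? ¬p)

  select-≟ : ∀ y (f : Bool → ℚ) →
             f true when does (true Bool.≟ y) + f false when does (false Bool.≟ y) ≡ f y
  select-≟ true  f = ℚ.+-identityʳ (f true)
  select-≟ false f = ℚ.+-identityˡ (f false)

  expand-≟ : ∀ l (g : Bool → ℚ) Y →
             g l * Y ≡ g true * (Y when does (l Bool.≟ true)) + g false * (Y when does (l Bool.≟ false))
  expand-≟ true  g Y = sym (trans (cong (g true * Y +_) (ℚ.*-zeroʳ (g false))) (ℚ.+-identityʳ _))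
  expand-≟ false g Y = sym (trans (cong (_+ g false * Y) (ℚ.*-zeroʳ (g true))) (ℚ.+-identityˡ _))

  *-when-∧ : ∀ X Y L c → X * Y when (L ∧ c) ≡ (Y when c) * (X when L)
  *-when-∧ X Y true  true  = ℚ.*-comm X Y
  *-when-∧ X Y true  false = sym (ℚ.*-zeroˡ X)
  *-when-∧ X Y false c     = sym (ℚ.*-zeroʳ (Y when c))

  does-≟-true : ∀ b → does (b Bool.≟ true) ≡ b
  does-≟-true true  = refl
  does-≟-true false = refl

  sumOver : {A : Set} → List A → (A → ℚ) → ℚ
  sumOver xs f = sumℚ (map f xs)

  syntax sumOver xs (λ x → e) = Σ[ x ∈ xs ] e

  module _ {A : Set} where

    Σ-cong : ∀ (xs : List A) {f g : A → ℚ} → (∀ x → f x ≡ g x) → sumOver xs f ≡ sumOver xs g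
    Σ-cong xs f≗g = cong sumℚ (List.map-cong f≗g xs)

    Σ-++ : ∀ (xs ys : List A) f → sumOver (xs ++ ys) f ≡ sumOver xs f + sumOver ys f
    Σ-++ []       ys f = sym (ℚ.+-identityˡ _)
    Σ-++ (x ∷ xs) ys f = trans (cong (f x +_) (Σ-++ xs ys f)) (sym (ℚ.+-assoc (f x) _ _))

    Σ-+ : ∀ (xs : List A) f g → Σ[ x ∈ xs ] (f x + g x) ≡ sumOver xs f + sumOver xs g
    Σ-+ []       f g = refl
    Σ-+ (x ∷ xs) f g = trans (cong (f x + g x +_) (Σ-+ xs f g))
                             (interchange (f x) (g x) (sumOver xs f) (sumOver xs g))
      where
      interchange : ∀ a b c d → (a + b) + (c + d) ≡ (a + c) + (b + d)
      interchange = solve-∀ ℚ-ring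

    Σ-* : ∀ (xs : List A) c f → Σ[ x ∈ xs ] (c * f x) ≡ c * sumOver xs f
    Σ-* []       c f = sym (ℚ.*-zeroʳ c)
    Σ-* (x ∷ xs) c f = trans (cong (c * f x +_) (Σ-* xs c f)) (sym (ℚ.*-distribˡ-+ c (f x) _))

    Σ-filter : ∀ {P : Pred A 0ℓ} (P? : Decidable P) f xs →
               sumℚ (map f (filter P? xs)) ≡ Σ[ x ∈ xs ] (f x when does (P? x))
    Σ-filter P? f []       = refl
    Σ-filter P? f (x ∷ xs) with does (P? x)
    ... | true  = cong (f x +_) (Σ-filter P? f xs)
    ... | false = trans (Σ-filter P? f xs) (sym (ℚ.+-identityˡ _))

  Σ-concatMap : ∀ {A B : Set} (g : A → List B) xs f →
                sumOver (concatMap g xs) f ≡ Σ[ x ∈ xs ] sumOver (g x) f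
  Σ-concatMap g []       f = refl
  Σ-concatMap g (x ∷ xs) f =
    trans (Σ-++ (g x) (concatMap g xs) f) (cong (sumOver (g x) f +_) (Σ-concatMap g xs f))

  ^ℕ-+ : ∀ x m n → x ^ℕ (m ℕ.+ n) ≡ x ^ℕ m * x ^ℕ n
  ^ℕ-+ x zero    n = sym (ℚ.*-identityˡ _)
  ^ℕ-+ x (suc m) n = trans (cong (x *_) (^ℕ-+ x m n)) (sym (ℚ.*-assoc x _ _))

  -- Recursion on this view is recursion on the binary expansion: odd and even append 1 and 0.
  data Binary : ℕ → Set where
    zero : Binary 0
    odd  : ∀ {m} → Binary m → Binary (suc (2 ℕ.* m))
    even : ∀ {m} → Binary (suc m) → Binary (2 ℕ.* suc m)

  binary-suc : ∀ {n} → Binary n → Binary (suc n)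
  binary-suc zero        = odd zero
  binary-suc (odd {m} b) = subst Binary (ℕ.*-suc 2 m) (even (binary-suc b))
  binary-suc (even b)    = odd b

  binary : ∀ n → Binary n
  binary zero    = zero
  binary (suc n) = binary-suc (binary n)

  module Hyperbinary (q : ℚ) where

    hqUpTo : ℕ → ℕ → ℚ
    hqUpTo k N = Σ[ v ∈ allVecs k ] (q ^ℕ numParts v when does (weight v ℕ.≟ N))

    -- d ∈ {0, 1, 2} parts equal to 1 next to parts 2, 4, … summing to 2 w.
    lowestPartSum : ℕ → ℚ → ℕ → ℚ
    lowestPartSum w X N =
        X when does (2 ℕ.* w ℕ.≟ N)
      + (q * X when does (suc (2 ℕ.* w) ℕ.≟ N)
      + (q * (q * X) when does (2 ℕ.+ 2 ℕ.* w ℕ.≟ N) + 0ℚ))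

    hqUpTo-suc : ∀ k N →
      hqUpTo (suc k) N ≡ Σ[ v ∈ allVecs k ] lowestPartSum (weight v) (q ^ℕ numParts v) N
    hqUpTo-suc k N = Σ-concatMap _ (allVecs k) _

    lowestPartSum-zero : ∀ w X → lowestPartSum w X 0 ≡ X when does (w ℕ.≟ 0)
    lowestPartSum-zero w X = begin
      lowestPartSum w X 0
        ≡⟨ cong₂ _+_ (when-⇔ (2 ℕ.* w ℕ.≟ 0) (w ℕ.≟ 0) X (ℕ.*-cancelˡ-≡ w 0 2) (cong (2 ℕ.*_)))
                     (cong₂ _+_ (when-¬ (suc (2 ℕ.* w) ℕ.≟ 0) (q * X) λ ())
                                (cong (_+ 0ℚ) (when-¬ (2 ℕ.+ 2 ℕ.* w ℕ.≟ 0) (q * (q * X)) λ ()))) ⟩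
      X when does (w ℕ.≟ 0) + (0ℚ + (0ℚ + 0ℚ))
        ≡⟨ ℚ.+-identityʳ _ ⟩
      X when does (w ℕ.≟ 0) ∎
      where open ≡-Reasoning

    lowestPartSum-odd : ∀ w X m → lowestPartSum w X (suc (2 ℕ.* m)) ≡ q * (X when does (w ℕ.≟ m))
    lowestPartSum-odd w X m = begin
      lowestPartSum w X (suc (2 ℕ.* m))
        ≡⟨ cong₂ _+_ (when-¬ (2 ℕ.* w ℕ.≟ suc (2 ℕ.* m)) X (ℕ.even≢odd w m))
                     (cong₂ _+_ (when-⇔ (suc (2 ℕ.* w) ℕ.≟ suc (2 ℕ.* m)) (w ℕ.≟ m) (q * X)
                                   (ℕ.*-cancelˡ-≡ w m 2 ∘ ℕ.suc-injective) (cong (suc ∘ (2 ℕ.*_))))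
                                (cong (_+ 0ℚ) (when-¬ (2 ℕ.+ 2 ℕ.* w ℕ.≟ suc (2 ℕ.* m)) (q * (q * X))
                                   (ℕ.even≢odd m w ∘ sym ∘ ℕ.suc-injective)))) ⟩
      0ℚ + (q * X when does (w ℕ.≟ m) + (0ℚ + 0ℚ))
        ≡⟨ trans (ℚ.+-identityˡ _) (ℚ.+-identityʳ _) ⟩
      q * X when does (w ℕ.≟ m)
        ≡⟨ *-when q X (does (w ℕ.≟ m)) ⟩
      q * (X when does (w ℕ.≟ m)) ∎
      where open ≡-Reasoning

    lowestPartSum-even : ∀ w X m → lowestPartSum w X (2 ℕ.* suc m) ≡
                         X when does (w ℕ.≟ suc m) + q * (q * (X when does (w ℕ.≟ m)))
    lowestPartSum-even w X m = begin
      lowestPartSum w X (2 ℕ.* suc m)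
        ≡⟨ cong₂ _+_ (when-⇔ (2 ℕ.* w ℕ.≟ 2 ℕ.* suc m) (w ℕ.≟ suc m) X
                        (ℕ.*-cancelˡ-≡ w (suc m) 2) (cong (2 ℕ.*_)))
                     (cong₂ _+_ (when-¬ (suc (2 ℕ.* w) ℕ.≟ 2 ℕ.* suc m) (q * X)
                                   (ℕ.even≢odd (suc m) w ∘ sym))
                                (cong (_+ 0ℚ) (when-⇔ (2 ℕ.+ 2 ℕ.* w ℕ.≟ 2 ℕ.* suc m) (w ℕ.≟ m) (q * (q * X))
                                   (ℕ.suc-injective ∘ ℕ.*-cancelˡ-≡ (suc w) (suc m) 2 ∘ trans (ℕ.*-suc 2 w))
                                   (λ e → trans (cong (λ x → 2 ℕ.+ 2 ℕ.* x) e) (sym (ℕ.*-suc 2 m)))))) ⟩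
      X when does (w ℕ.≟ suc m) + (0ℚ + (q * (q * X) when does (w ℕ.≟ m) + 0ℚ))
        ≡⟨ cong (X when does (w ℕ.≟ suc m) +_) (trans (ℚ.+-identityˡ _) (trans (ℚ.+-identityʳ _)
             (trans (*-when q (q * X) (does (w ℕ.≟ m))) (cong (q *_) (*-when q X (does (w ℕ.≟ m))))))) ⟩
      X when does (w ℕ.≟ suc m) + q * (q * (X when does (w ℕ.≟ m))) ∎
      where open ≡-Reasoning

    hqUpTo-zero : ∀ k → hqUpTo (suc k) 0 ≡ hqUpTo k 0
    hqUpTo-zero k = trans (hqUpTo-suc k 0) (Σ-cong (allVecs k) λ v → lowestPartSum-zero (weight v) _)

    hqUpTo-odd : ∀ k m → hqUpTo (suc k) (suc (2 ℕ.* m)) ≡ q * hqUpTo k m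
    hqUpTo-odd k m = trans (hqUpTo-suc k _)
      (trans (Σ-cong (allVecs k) λ v → lowestPartSum-odd (weight v) _ m) (Σ-* (allVecs k) q _))

    hqUpTo-even : ∀ k m → hqUpTo (suc k) (2 ℕ.* suc m) ≡ hqUpTo k (suc m) + q * (q * hqUpTo k m)
    hqUpTo-even k m = trans (hqUpTo-suc k _)
      (trans (Σ-cong (allVecs k) λ v → lowestPartSum-even (weight v) _ m)
      (trans (Σ-+ (allVecs k) _ _)
             (cong (hqUpTo k (suc m) +_) (trans (Σ-* (allVecs k) q _) (cong (q *_) (Σ-* (allVecs k) q _))))))

    hqUpTo-stable : ∀ {k N} → N ≤ k → hqUpTo (suc k) N ≡ hqUpTo k N
    hqUpTo-stable {k} {N} N≤k with binary N
    hqUpTo-stable {k} {.0} _ | zero = hqUpTo-zero k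
    hqUpTo-stable {suc k} {.(suc (2 ℕ.* m))} (s≤s 2m≤k) | odd {m} _ = begin
      hqUpTo (suc (suc k)) (suc (2 ℕ.* m)) ≡⟨ hqUpTo-odd (suc k) m ⟩
      q * hqUpTo (suc k) m
        ≡⟨ cong (q *_) (hqUpTo-stable (ℕ.≤-trans (ℕ.m≤m+n m _) 2m≤k)) ⟩
      q * hqUpTo k m                       ≡⟨ sym (hqUpTo-odd k m) ⟩
      hqUpTo (suc k) (suc (2 ℕ.* m))       ∎
      where open ≡-Reasoning
    hqUpTo-stable {suc k} {.(2 ℕ.* suc m)} 2[1+m]≤1+k | even {m} _ = begin
      hqUpTo (suc (suc k)) (2 ℕ.* suc m)                  ≡⟨ hqUpTo-even (suc k) m ⟩
      hqUpTo (suc k) (suc m) + q * (q * hqUpTo (suc k) m)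
        ≡⟨ cong₂ (λ x y → x + q * (q * y)) (hqUpTo-stable 1+m≤k) (hqUpTo-stable (ℕ.<⇒≤ 1+m≤k)) ⟩
      hqUpTo k (suc m) + q * (q * hqUpTo k m)             ≡⟨ sym (hqUpTo-even k m) ⟩
      hqUpTo (suc k) (2 ℕ.* suc m)                        ∎
      where
      open ≡-Reasoning
      1+m≤k : suc m ≤ k
      1+m≤k = ℕ.s≤s⁻¹ (ℕ.<-≤-trans (ℕ.m<m+n (suc m) z<s) 2[1+m]≤1+k)

    hq≡hqUpTo : ∀ N → hq q N ≡ hqUpTo (suc N) N
    hq≡hqUpTo N = Σ-filter (λ v → weight v ℕ.≟ N) (q ^ℕ_ ∘ numParts) (allVecs (suc N))

    hqUpTo≡hq : ∀ {k N} → N < k → hqUpTo k N ≡ hq q N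
    hqUpTo≡hq = go ∘ ℕ.≤⇒≤′
      where
      go : ∀ {k N} → suc N ≤′ k → hqUpTo k N ≡ hq q N
      go {N = N} ≤′-refl = sym (hq≡hqUpTo N)
      go (≤′-step N<k)   = trans (hqUpTo-stable (ℕ.<⇒≤ (ℕ.≤′⇒≤ N<k))) (go N<k)

    hq-zero : hq q 0 ≡ 1ℚ
    hq-zero = trans (hq≡hqUpTo 0) (hqUpTo-zero 0)

    hq-odd : ∀ m → hq q (suc (2 ℕ.* m)) ≡ q * hq q m
    hq-odd m = trans (hq≡hqUpTo (suc (2 ℕ.* m))) (trans (hqUpTo-odd (suc (2 ℕ.* m)) m)
      (cong (q *_) (hqUpTo≡hq (s≤s (ℕ.m≤m+n m (m ℕ.+ 0))))))

    hq-even : ∀ m → hq q (2 ℕ.* suc m) ≡ hq q (suc m) + q * (q * hq q m)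
    hq-even m = trans (hq≡hqUpTo (2 ℕ.* suc m)) (trans (hqUpTo-even (2 ℕ.* suc m) m)
      (cong₂ (λ x y → x + q * (q * y))
             (hqUpTo≡hq 1+m<2[1+m]) (hqUpTo≡hq (ℕ.<-trans (ℕ.n<1+n m) 1+m<2[1+m]))))
      where
      1+m<2[1+m] : suc m < 2 ℕ.* suc m
      1+m<2[1+m] = ℕ.m<m+n (suc m) z<s

  lsb : ℕ → List Bool
  lsb n = lsbDigits n n

  lsbDigits-zero : ∀ f → lsbDigits f 0 ≡ []
  lsbDigits-zero zero    = refl
  lsbDigits-zero (suc f) = refl

  [1+m]/2≤m : ∀ m → suc m / 2 ≤ m
  [1+m]/2≤m m = ℕ.s≤s⁻¹ (m/n<m (suc m) 2 (s≤s (s≤s ℕ.z≤n)))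

  lsbDigits-fuel : ∀ {f g} m → m ≤ f → m ≤ g → lsbDigits f m ≡ lsbDigits g m
  lsbDigits-fuel {f} {g} zero _ _ = trans (lsbDigits-zero f) (sym (lsbDigits-zero g))
  lsbDigits-fuel (suc m) (s≤s m≤f) (s≤s m≤g) = cong (does (suc m % 2 ℕ.≟ 1) ∷_)
    (lsbDigits-fuel (suc m / 2) (ℕ.≤-trans ([1+m]/2≤m m) m≤f) (ℕ.≤-trans ([1+m]/2≤m m) m≤g))

  lsb-suc : ∀ m → lsb (suc m) ≡ does (suc m % 2 ℕ.≟ 1) ∷ lsb (suc m / 2)
  lsb-suc m = cong (does (suc m % 2 ℕ.≟ 1) ∷_) (lsbDigits-fuel (suc m / 2) ([1+m]/2≤m m) ℕ.≤-refl)

  lsb-odd : ∀ m → lsb (suc (2 ℕ.* m)) ≡ true ∷ lsb m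
  lsb-odd m = trans (lsb-suc (2 ℕ.* m)) (cong₂ (λ r n → does (r ℕ.≟ 1) ∷ lsb n) [1+2m]%2≡1 [1+2m]/2≡m)
    where
    [1+2m]%2≡1 : suc (2 ℕ.* m) % 2 ≡ 1
    [1+2m]%2≡1 = trans (cong (_% 2) (cong suc (ℕ.*-comm 2 m))) ([m+kn]%n≡m%n 1 m 2)
    [1+2m]/2≡m : suc (2 ℕ.* m) / 2 ≡ m
    [1+2m]/2≡m = trans (cong (_/ 2) (cong suc (ℕ.*-comm 2 m)))
                       (trans (+-distrib-/-∣ʳ 1 {d = 2} (divides-refl m)) (m*n/n≡m m 2))

  lsb-even : ∀ m → lsb (2 ℕ.* suc m) ≡ false ∷ lsb (suc m)
  lsb-even m = trans (lsb-suc (ℕ.pred (2 ℕ.* suc m)))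
                     (cong₂ (λ r n → does (r ℕ.≟ 1) ∷ lsb n) [2+2m]%2≡0 [2+2m]/2≡1+m)
    where
    [2+2m]%2≡0 : 2 ℕ.* suc m % 2 ≡ 0
    [2+2m]%2≡0 = trans (cong (_% 2) (ℕ.*-comm 2 (suc m))) (m*n%n≡0 (suc m) 2)
    [2+2m]/2≡1+m : 2 ℕ.* suc m / 2 ≡ suc m
    [2+2m]/2≡1+m = trans (cong (_/ 2) (ℕ.*-comm 2 (suc m))) (m*n/n≡m (suc m) 2)

  β-odd : ∀ m → β (suc (2 ℕ.* m)) ≡ β m ∷ʳ true
  β-odd m = trans (cong reverse (lsb-odd m)) (List.unfold-reverse true (lsb m))

  β-even : ∀ m → β (2 ℕ.* suc m) ≡ β (suc m) ∷ʳ false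
  β-even m = trans (cong reverse (lsb-even m)) (List.unfold-reverse false (lsb (suc m)))

  β-suc≢[] : ∀ m → β (suc m) ≢ []
  β-suc≢[] m β≡[] = ℕ.1+n≢0 (trans (sym (List.length-reverse (lsb (suc m)))) (cong length β≡[]))

  principalPrefix-lsb : ∀ N → principalPrefix N ≡ reverse (afterFirstZero (lsb N))
  principalPrefix-lsb N = cong (reverse ∘ afterFirstZero) (List.reverse-involutive (lsb N))

  principalPrefix-odd : ∀ m → principalPrefix (suc (2 ℕ.* m)) ≡ principalPrefix m
  principalPrefix-odd m = trans (principalPrefix-lsb (suc (2 ℕ.* m)))
    (trans (cong (reverse ∘ afterFirstZero) (lsb-odd m)) (sym (principalPrefix-lsb m)))

  principalPrefix-even : ∀ m → principalPrefix (2 ℕ.* suc m) ≡ β (suc m)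
  principalPrefix-even m = trans (principalPrefix-lsb (2 ℕ.* suc m)) (cong (reverse ∘ afterFirstZero) (lsb-even m))

  ones-++ : ∀ xs ys → ones (xs ++ ys) ≡ ones xs ℕ.+ ones ys
  ones-++ []           ys = refl
  ones-++ (true ∷ xs)  ys = cong suc (ones-++ xs ys)
  ones-++ (false ∷ xs) ys = ones-++ xs ys

  ones-β-odd : ∀ m → ones (β (suc (2 ℕ.* m))) ≡ suc (ones (β m))
  ones-β-odd m = trans (cong ones (β-odd m)) (trans (ones-++ (β m) [ true ]) (ℕ.+-comm (ones (β m)) 1))

  ones-β-even : ∀ m → ones (β (2 ℕ.* suc m)) ≡ ones (β (suc m))
  ones-β-even m = trans (cong ones (β-even m)) (trans (ones-++ (β (suc m)) [ false ]) (ℕ.+-identityʳ _))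

  zeros : List Bool → ℕ
  zeros = ones ∘ map not

  zeros-++ : ∀ xs ys → zeros (xs ++ ys) ≡ zeros xs ℕ.+ zeros ys
  zeros-++ xs ys = trans (cong ones (List.map-++ not xs ys)) (ones-++ (map not xs) (map not ys))

  -- Membership of the last element x_ρ; junk value false for the empty word.
  top : List Bool → Bool
  top []           = false
  top (x ∷ [])     = x
  top (_ ∷ y ∷ ys) = top (y ∷ ys)

  top-∷ʳ : ∀ a x → top (a ∷ʳ x) ≡ x
  top-∷ʳ []          x = refl
  top-∷ʳ (_ ∷ [])    x = refl
  top-∷ʳ (_ ∷ y ∷ a) x = top-∷ʳ (y ∷ a) x

  isLowerIdeal-∷ʳ : ∀ {w a} b y → w ≢ [] → length a ≡ length w →
                    isLowerIdeal (w ∷ʳ b) (a ∷ʳ y) ≡ isLowerIdeal w a ∧ coverOK b (top a) y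
  isLowerIdeal-∷ʳ {[]}        b y w≢[] _ = contradiction refl w≢[]
  isLowerIdeal-∷ʳ {_ ∷ []}    {d ∷ []} b y _ _ = Bool.∧-identityʳ (coverOK b d y)
  isLowerIdeal-∷ʳ {_ ∷ e ∷ w} {d ∷ f ∷ a} b y _ len =
    trans (cong (coverOK e d f ∧_) (isLowerIdeal-∷ʳ {e ∷ w} {f ∷ a} b y (λ ()) (ℕ.suc-injective len)))
          (sym (Bool.∧-assoc (coverOK e d f) _ _))
  isLowerIdeal-∷ʳ {_ ∷ _}     {[]}        _ _ _ ()
  isLowerIdeal-∷ʳ {_ ∷ []}    {_ ∷ _ ∷ _} _ _ _ ()
  isLowerIdeal-∷ʳ {_ ∷ _ ∷ _} {_ ∷ []}    _ _ _ ()

  Σ-subsets-cong : ∀ k {f g : List Bool → ℚ} → (∀ a → length a ≡ k → f a ≡ g a) →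
                   sumOver (subsets k) f ≡ sumOver (subsets k) g
  Σ-subsets-cong zero    f≗g = cong (_+ 0ℚ) (f≗g [] refl)
  Σ-subsets-cong (suc k) {f} {g} f≗g = begin
    sumOver (subsets (suc k)) f                       ≡⟨ Σ-concatMap _ (subsets k) f ⟩
    Σ[ a ∈ subsets k ] (f (true ∷ a) + (f (false ∷ a) + 0ℚ))
      ≡⟨ Σ-subsets-cong k (λ a len → cong₂ _+_ (f≗g (true ∷ a) (cong suc len))
                                                (cong (_+ 0ℚ) (f≗g (false ∷ a) (cong suc len)))) ⟩
    Σ[ a ∈ subsets k ] (g (true ∷ a) + (g (false ∷ a) + 0ℚ)) ≡⟨ Σ-concatMap _ (subsets k) g ⟨
    sumOver (subsets (suc k)) g                       ∎
    where open ≡-Reasoning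

  Σ-subsets-∷ʳ : ∀ k (f : List Bool → ℚ) →
                 sumOver (subsets (suc k)) f ≡ Σ[ a ∈ subsets k ] (f (a ∷ʳ true) + f (a ∷ʳ false))
  Σ-subsets-∷ʳ zero    f = shift (f [ true ]) (f [ false ])
    where
    shift : ∀ x y → x + (y + 0ℚ) ≡ (x + y) + 0ℚ
    shift = solve-∀ ℚ-ring
  Σ-subsets-∷ʳ (suc k) f = begin
    sumOver (subsets (suc (suc k))) f
      ≡⟨ Σ-concatMap _ (subsets (suc k)) f ⟩
    Σ[ a ∈ subsets (suc k) ] (f (true ∷ a) + (f (false ∷ a) + 0ℚ))
      ≡⟨ Σ-subsets-∷ʳ k _ ⟩
    Σ[ a ∈ subsets k ] ((f ((true ∷ a) ∷ʳ true) + (f ((false ∷ a) ∷ʳ true) + 0ℚ))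
                      + (f ((true ∷ a) ∷ʳ false) + (f ((false ∷ a) ∷ʳ false) + 0ℚ)))
      ≡⟨ Σ-cong (subsets k) (λ a → swap (f ((true ∷ a) ∷ʳ true)) (f ((true ∷ a) ∷ʳ false))
                                        (f ((false ∷ a) ∷ʳ true)) (f ((false ∷ a) ∷ʳ false))) ⟩
    Σ[ a ∈ subsets k ] ((f ((true ∷ a) ∷ʳ true) + f ((true ∷ a) ∷ʳ false))
                      + ((f ((false ∷ a) ∷ʳ true) + f ((false ∷ a) ∷ʳ false)) + 0ℚ))
      ≡⟨ Σ-concatMap _ (subsets k) _ ⟨
    Σ[ a ∈ subsets (suc k) ] (f (a ∷ʳ true) + f (a ∷ʳ false)) ∎
    where
    open ≡-Reasoning
    swap : ∀ w x y z → (w + (y + 0ℚ)) + (x + (z + 0ℚ)) ≡ (w + x) + ((y + z) + 0ℚ)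
    swap = solve-∀ ℚ-ring

  module IdealSums (q : ℚ) where

    -- Weighting by q^|𝓕(w) ∖ I| instead of t^|I| keeps all identities polynomial in q.
    idealSum : List Bool → ℚ
    idealSum w = Σ[ a ∈ subsets (length w) ] (q ^ℕ zeros a when isLowerIdeal w a)

    topIdealSum : List Bool → Bool → ℚ
    topIdealSum w x = Σ[ a ∈ subsets (length w) ] (q ^ℕ zeros a when isLowerIdeal w a when does (top a Bool.≟ x))

    idealSum-top : ∀ w → idealSum w ≡ topIdealSum w true + topIdealSum w false
    idealSum-top w = trans (Σ-cong (subsets (length w)) (λ a → split (top a) _)) (Σ-+ (subsets (length w)) _ _)
      where
      split : ∀ l Y → Y ≡ Y when does (l Bool.≟ true) + Y when does (l Bool.≟ false)
      split true  Y = sym (ℚ.+-identityʳ Y)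
      split false Y = sym (ℚ.+-identityˡ Y)

    transfer : Bool → Bool → Bool → ℚ
    transfer b x y = q ^ℕ zeros [ y ] when coverOK b x y

    topIdealSum-∷ʳ : ∀ {w} b y → w ≢ [] →
      topIdealSum (w ∷ʳ b) y ≡ transfer b true y * topIdealSum w true + transfer b false y * topIdealSum w false
    topIdealSum-∷ʳ {w} b y w≢[] = begin
      topIdealSum (w ∷ʳ b) y
        ≡⟨ cong (λ k → sumOver (subsets k) F) (List.length-++-comm w [ b ]) ⟩
      sumOver (subsets (suc (length w))) F
        ≡⟨ Σ-subsets-∷ʳ (length w) F ⟩
      Σ[ a ∈ subsets (length w) ] (F (a ∷ʳ true) + F (a ∷ʳ false))
        ≡⟨ Σ-subsets-cong (length w) pointwise ⟩
      Σ[ a ∈ subsets (length w) ] (transfer b true y * G true a + transfer b false y * G false a)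
        ≡⟨ Σ-+ (subsets (length w)) _ _ ⟩
      Σ[ a ∈ subsets (length w) ] (transfer b true y * G true a)
        + Σ[ a ∈ subsets (length w) ] (transfer b false y * G false a)
        ≡⟨ cong₂ _+_ (Σ-* (subsets (length w)) (transfer b true y) (G true))
                     (Σ-* (subsets (length w)) (transfer b false y) (G false)) ⟩
      transfer b true y * topIdealSum w true + transfer b false y * topIdealSum w false ∎
      where
      open ≡-Reasoning
      F : List Bool → ℚ
      F a = q ^ℕ zeros a when isLowerIdeal (w ∷ʳ b) a when does (top a Bool.≟ y)
      G : Bool → List Bool → ℚ
      G x a = q ^ℕ zeros a when isLowerIdeal w a when does (top a Bool.≟ x)
      H : List Bool → Bool → ℚ
      H a z = q ^ℕ zeros a * q ^ℕ zeros [ z ] when (isLowerIdeal w a ∧ coverOK b (top a) z)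

      F-∷ʳ : ∀ a z → length a ≡ length w → F (a ∷ʳ z) ≡ H a z when does (z Bool.≟ y)
      F-∷ʳ a z len = cong₂ _when_
        (cong₂ _when_ (trans (cong (q ^ℕ_) (zeros-++ a [ z ])) (^ℕ-+ q (zeros a) (zeros [ z ])))
                      (isLowerIdeal-∷ʳ b z w≢[] len))
        (cong (λ l → does (l Bool.≟ y)) (top-∷ʳ a z))

      pointwise : ∀ a → length a ≡ length w →
        F (a ∷ʳ true) + F (a ∷ʳ false) ≡ transfer b true y * G true a + transfer b false y * G false a
      pointwise a len = begin
        F (a ∷ʳ true) + F (a ∷ʳ false)
          ≡⟨ cong₂ _+_ (F-∷ʳ a true len) (F-∷ʳ a false len) ⟩
        H a true when does (true Bool.≟ y) + H a false when does (false Bool.≟ y)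
          ≡⟨ select-≟ y (H a) ⟩
        H a y
          ≡⟨ *-when-∧ (q ^ℕ zeros a) (q ^ℕ zeros [ y ]) (isLowerIdeal w a) (coverOK b (top a) y) ⟩
        transfer b (top a) y * (q ^ℕ zeros a when isLowerIdeal w a)
          ≡⟨ expand-≟ (top a) (λ x → transfer b x y) _ ⟩
        transfer b true y * G true a + transfer b false y * G false a ∎

  module TransferRecursion (q : ℚ) where
    open Hyperbinary q
    open IdealSums q

    scaledTopSum : List Bool → Bool → ℚ
    scaledTopSum w x = q ^ℕ ones w * topIdealSum w x

    scaledTopSum-∷ʳ : ∀ {w} b y → w ≢ [] → scaledTopSum (w ∷ʳ b) y ≡
      q ^ℕ ones [ b ] * (transfer b true y * scaledTopSum w true + transfer b false y * scaledTopSum w false)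
    scaledTopSum-∷ʳ {w} b y w≢[] = begin
      scaledTopSum (w ∷ʳ b) y
        ≡⟨ cong₂ _*_ (trans (cong (q ^ℕ_) (ones-++ w [ b ])) (^ℕ-+ q (ones w) (ones [ b ])))
                     (topIdealSum-∷ʳ b y w≢[]) ⟩
      (q ^ℕ ones w * q ^ℕ ones [ b ])
        * (transfer b true y * topIdealSum w true + transfer b false y * topIdealSum w false)
        ≡⟨ distribute (q ^ℕ ones w) (q ^ℕ ones [ b ]) (transfer b true y) (transfer b false y)
                      (topIdealSum w true) (topIdealSum w false) ⟩
      q ^ℕ ones [ b ] * (transfer b true y * scaledTopSum w true + transfer b false y * scaledTopSum w false) ∎
      where
      open ≡-Reasoning
      distribute : ∀ P B T U X Y → (P * B) * (T * X + U * Y) ≡ B * (T * (P * X) + U * (P * Y))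
      distribute = solve-∀ ℚ-ring

    -- For fixed digits, transfer and q ^ℕ ones [ b ] reduce to 0ℚ, 1ℚ or q * 1ℚ.
    module _ {w : List Bool} (w≢[] : w ≢ []) where

      scaledTopSum-∷ʳ0-∈ : scaledTopSum (w ∷ʳ false) true ≡ scaledTopSum w true + scaledTopSum w false
      scaledTopSum-∷ʳ0-∈ = trans (scaledTopSum-∷ʳ false true w≢[])
                             (simplify (scaledTopSum w true) (scaledTopSum w false))
        where
        simplify : ∀ X Y → 1ℚ * (1ℚ * X + 1ℚ * Y) ≡ X + Y
        simplify = solve-∀ ℚ-ring

      scaledTopSum-∷ʳ0-∉ : scaledTopSum (w ∷ʳ false) false ≡ q * scaledTopSum w false
      scaledTopSum-∷ʳ0-∉ = trans (scaledTopSum-∷ʳ false false w≢[])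
                             (simplify q (scaledTopSum w true) (scaledTopSum w false))
        where
        simplify : ∀ q X Y → 1ℚ * (0ℚ * X + (q * 1ℚ) * Y) ≡ q * Y
        simplify = solve-∀ ℚ-ring

      scaledTopSum-∷ʳ1-∈ : scaledTopSum (w ∷ʳ true) true ≡ q * scaledTopSum w true
      scaledTopSum-∷ʳ1-∈ = trans (scaledTopSum-∷ʳ true true w≢[])
                             (simplify q (scaledTopSum w true) (scaledTopSum w false))
        where
        simplify : ∀ q X Y → (q * 1ℚ) * (1ℚ * X + 0ℚ * Y) ≡ q * X
        simplify = solve-∀ ℚ-ring

      scaledTopSum-∷ʳ1-∉ :
        scaledTopSum (w ∷ʳ true) false ≡ q * (q * (scaledTopSum w true + scaledTopSum w false))
      scaledTopSum-∷ʳ1-∉ = trans (scaledTopSum-∷ʳ true false w≢[])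
                             (simplify q (scaledTopSum w true) (scaledTopSum w false))
        where
        simplify : ∀ q X Y → (q * 1ℚ) * ((q * 1ℚ) * X + (q * 1ℚ) * Y) ≡ q * (q * (X + Y))
        simplify = solve-∀ ℚ-ring

    record TopSums (N : ℕ) : Set where
      constructor _,_
      field
        top∈ : scaledTopSum (β N) true  ≡ hq q N
        top∉ : scaledTopSum (β N) false ≡ q * (q * hq q (N ∸ 1))

    -- β 1 = [ true ], so both sums evaluate by computation.
    topSums-1 : TopSums 1
    topSums-1 = trans (ℚ.*-identityʳ (q * 1ℚ)) (sym hq-1)
              , trans (simplify q) (cong (λ x → q * (q * x)) (sym hq-zero))
      where
      hq-1 : hq q 1 ≡ q * 1ℚ
      hq-1 = trans (hq-odd 0) (cong (q *_) hq-zero)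
      simplify : ∀ q → (q * 1ℚ) * (0ℚ + (q * 1ℚ + 0ℚ)) ≡ q * (q * 1ℚ)
      simplify = solve-∀ ℚ-ring

    topSums-odd : ∀ {m} → TopSums (suc m) → TopSums (suc (2 ℕ.* suc m))
    topSums-odd {m} (top∈ , top∉) =
      (begin
        scaledTopSum (β (suc (2 ℕ.* suc m))) true ≡⟨ cong (λ w → scaledTopSum w true) (β-odd (suc m)) ⟩
        scaledTopSum (β (suc m) ∷ʳ true) true     ≡⟨ scaledTopSum-∷ʳ1-∈ (β-suc≢[] m) ⟩
        q * scaledTopSum (β (suc m)) true         ≡⟨ cong (q *_) top∈ ⟩
        q * hq q (suc m)                          ≡⟨ hq-odd (suc m) ⟨
        hq q (suc (2 ℕ.* suc m))                  ∎)
      , (begin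
        scaledTopSum (β (suc (2 ℕ.* suc m))) false ≡⟨ cong (λ w → scaledTopSum w false) (β-odd (suc m)) ⟩
        scaledTopSum (β (suc m) ∷ʳ true) false     ≡⟨ scaledTopSum-∷ʳ1-∉ (β-suc≢[] m) ⟩
        q * (q * (scaledTopSum (β (suc m)) true + scaledTopSum (β (suc m)) false))
          ≡⟨ cong (λ x → q * (q * x)) (trans (cong₂ _+_ top∈ top∉) (sym (hq-even m))) ⟩
        q * (q * hq q (2 ℕ.* suc m))               ∎)
      where open ≡-Reasoning

    topSums-even : ∀ {m} → TopSums (suc m) → TopSums (2 ℕ.* suc m)
    topSums-even {m} (top∈ , top∉) =
      (begin
        scaledTopSum (β (2 ℕ.* suc m)) true ≡⟨ cong (λ w → scaledTopSum w true) (β-even m) ⟩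
        scaledTopSum (β (suc m) ∷ʳ false) true ≡⟨ scaledTopSum-∷ʳ0-∈ (β-suc≢[] m) ⟩
        scaledTopSum (β (suc m)) true + scaledTopSum (β (suc m)) false ≡⟨ cong₂ _+_ top∈ top∉ ⟩
        hq q (suc m) + q * (q * hq q m) ≡⟨ hq-even m ⟨
        hq q (2 ℕ.* suc m) ∎)
      , (begin
        scaledTopSum (β (2 ℕ.* suc m)) false ≡⟨ cong (λ w → scaledTopSum w false) (β-even m) ⟩
        scaledTopSum (β (suc m) ∷ʳ false) false ≡⟨ scaledTopSum-∷ʳ0-∉ (β-suc≢[] m) ⟩
        q * scaledTopSum (β (suc m)) false ≡⟨ cong (q *_) top∉ ⟩
        q * (q * (q * hq q m)) ≡⟨ cong (λ x → q * (q * x)) (hq-odd m) ⟨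
        q * (q * hq q (suc (2 ℕ.* m))) ≡⟨ cong (λ n → q * (q * hq q n)) (ℕ.+-suc m (m ℕ.+ 0)) ⟨
        q * (q * hq q (2 ℕ.* suc m ∸ 1)) ∎)
      where open ≡-Reasoning

    topSums : ∀ {m} → Binary (suc m) → TopSums (suc m)
    topSums (odd zero)       = topSums-1
    topSums (odd b@(odd _))  = topSums-odd (topSums b)
    topSums (odd b@(even _)) = topSums-odd (topSums b)
    topSums (even b)         = topSums-even (topSums b)

    hq-fence : ∀ {N} → Binary N → hq q N ≡ q ^ℕ ones (β N) * idealSum (principalPrefix N)
    hq-fence zero = hq-zero
    hq-fence (odd {m} b) = begin
      hq q (suc (2 ℕ.* m))                                 ≡⟨ hq-odd m ⟩
      q * hq q m                                           ≡⟨ cong (q *_) (hq-fence b) ⟩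
      q * (q ^ℕ ones (β m) * idealSum (principalPrefix m)) ≡⟨ ℚ.*-assoc q _ _ ⟨
      q ^ℕ suc (ones (β m)) * idealSum (principalPrefix m)
        ≡⟨ cong₂ (λ s w → q ^ℕ s * idealSum w) (ones-β-odd m) (principalPrefix-odd m) ⟨
      q ^ℕ ones (β (suc (2 ℕ.* m))) * idealSum (principalPrefix (suc (2 ℕ.* m))) ∎
      where open ≡-Reasoning
    hq-fence (even {m} b) = begin
      hq q (2 ℕ.* suc m)                                               ≡⟨ hq-even m ⟩
      hq q (suc m) + q * (q * hq q m)
        ≡⟨ cong₂ _+_ (TopSums.top∈ (topSums b)) (TopSums.top∉ (topSums b)) ⟨
      scaledTopSum (β (suc m)) true + scaledTopSum (β (suc m)) false
        ≡⟨ ℚ.*-distribˡ-+ (q ^ℕ ones (β (suc m)))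
                          (topIdealSum (β (suc m)) true) (topIdealSum (β (suc m)) false) ⟨
      q ^ℕ ones (β (suc m)) * (topIdealSum (β (suc m)) true + topIdealSum (β (suc m)) false)
        ≡⟨ cong (q ^ℕ ones (β (suc m)) *_) (idealSum-top (β (suc m))) ⟨
      q ^ℕ ones (β (suc m)) * idealSum (β (suc m))
        ≡⟨ cong₂ (λ s w → q ^ℕ s * idealSum w) (ones-β-even m) (principalPrefix-even m) ⟨
      q ^ℕ ones (β (2 ℕ.* suc m)) * idealSum (principalPrefix (2 ℕ.* suc m)) ∎
      where open ≡-Reasoning

  ^length*^ones : ∀ {q t} → q * t ≡ 1ℚ → ∀ a → q ^ℕ length a * t ^ℕ ones a ≡ q ^ℕ zeros a
  ^length*^ones qt [] = refl
  ^length*^ones {q} {t} qt (true ∷ a) = begin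
    (q * q ^ℕ length a) * (t * t ^ℕ ones a) ≡⟨ regroup q t (q ^ℕ length a) (t ^ℕ ones a) ⟩
    (q * t) * (q ^ℕ length a * t ^ℕ ones a) ≡⟨ cong₂ _*_ qt (^length*^ones qt a) ⟩
    1ℚ * q ^ℕ zeros a                       ≡⟨ ℚ.*-identityˡ _ ⟩
    q ^ℕ zeros a                            ∎
    where
    open ≡-Reasoning
    regroup : ∀ q t Q T → (q * Q) * (t * T) ≡ (q * t) * (Q * T)
    regroup = solve-∀ ℚ-ring
  ^length*^ones {q} qt (false ∷ a) = trans (ℚ.*-assoc q _ _) (cong (q *_) (^length*^ones qt a))

  q^fenceSize*rgf : ∀ {q t} → q * t ≡ 1ℚ → ∀ N →
                    q ^ℕ fenceSize N * rgf N t ≡ IdealSums.idealSum q (principalPrefix N)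
  q^fenceSize*rgf {q} {t} qt N = begin
    q ^ℕ ρ * rgf N t
      ≡⟨ cong (q ^ℕ ρ *_) (Σ-filter _ (λ a → t ^ℕ ones a) (subsets ρ)) ⟩
    q ^ℕ ρ * Σ[ a ∈ subsets ρ ] (t ^ℕ ones a when does (isLowerIdeal w a Bool.≟ true))
      ≡⟨ Σ-* (subsets ρ) (q ^ℕ ρ) _ ⟨
    Σ[ a ∈ subsets ρ ] (q ^ℕ ρ * (t ^ℕ ones a when does (isLowerIdeal w a Bool.≟ true)))
      ≡⟨ Σ-subsets-cong ρ pointwise ⟩
    IdealSums.idealSum q w ∎
    where
    open ≡-Reasoning
    w : List Bool
    w = principalPrefix N
    ρ : ℕ
    ρ = fenceSize N
    pointwise : ∀ a → length a ≡ ρ →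
      q ^ℕ ρ * (t ^ℕ ones a when does (isLowerIdeal w a Bool.≟ true)) ≡ q ^ℕ zeros a when isLowerIdeal w a
    pointwise a len = trans (sym (*-when (q ^ℕ ρ) (t ^ℕ ones a) (does (isLowerIdeal w a Bool.≟ true))))
      (cong₂ _when_ (trans (cong (λ k → q ^ℕ k * t ^ℕ ones a) (sym len)) (^length*^ones qt a))
                    (does-≟-true (isLowerIdeal w a)))

  hq-rgf : ∀ {q t} → q * t ≡ 1ℚ → ∀ N → hq q N ≡ q ^ℕ (fenceSize N ℕ.+ ones (β N)) * rgf N t
  hq-rgf {q} {t} qt N = begin
    hq q N                                                 ≡⟨ TransferRecursion.hq-fence q (binary N) ⟩
    q ^ℕ s * IdealSums.idealSum q (principalPrefix N)     ≡⟨ cong (q ^ℕ s *_) (q^fenceSize*rgf qt N) ⟨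
    q ^ℕ s * (q ^ℕ ρ * rgf N t)                           ≡⟨ regroup (q ^ℕ s) (q ^ℕ ρ) (rgf N t) ⟩
    (q ^ℕ ρ * q ^ℕ s) * rgf N t                           ≡⟨ cong (_* rgf N t) (^ℕ-+ q ρ s) ⟨
    q ^ℕ (ρ ℕ.+ s) * rgf N t                              ∎
    where
    open ≡-Reasoning
    ρ s : ℕ
    ρ = fenceSize N
    s = ones (β N)
    regroup : ∀ S P R → S * (P * R) ≡ (P * S) * R
    regroup = solve-∀ ℚ-ring

  *-inv : ∀ {x} → x ≢ 0ℚ → x * inv x ≡ 1ℚ
  *-inv {x} x≢0 with x ℚ.≟ 0ℚ
  ... | yes x≡0 = contradiction x≡0 x≢0
  ... | no  x≢0 = ℚ.*-inverseʳ x {{ℚ.≢-nonZero x≢0}}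

  inv-unique : ∀ {x y} → x * y ≡ 1ℚ → inv x ≡ y
  inv-unique {x} {y} xy≡1 = begin
    inv x           ≡⟨ ℚ.*-identityʳ (inv x) ⟨
    inv x * 1ℚ      ≡⟨ cong (inv x *_) xy≡1 ⟨
    inv x * (x * y) ≡⟨ ℚ.*-assoc (inv x) x y ⟨
    (inv x * x) * y ≡⟨ cong (_* y) (trans (ℚ.*-comm (inv x) x) (*-inv x≢0)) ⟩
    1ℚ * y          ≡⟨ ℚ.*-identityˡ y ⟩
    y               ∎
    where
    open ≡-Reasoning
    x≢0 : x ≢ 0ℚ
    x≢0 x≡0 with trans (sym xy≡1) (trans (cong (_* y) x≡0) (ℚ.*-zeroˡ y))
    ... | ()

  inv-* : ∀ x y → inv (x * y) ≡ inv x * inv y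
  inv-* x y = byCases (x ℚ.≟ 0ℚ) (y ℚ.≟ 0ℚ)
    where
    open ≡-Reasoning
    regroup : ∀ x y a b → (x * y) * (a * b) ≡ (x * a) * (y * b)
    regroup = solve-∀ ℚ-ring
    byCases : Dec (x ≡ 0ℚ) → Dec (y ≡ 0ℚ) → inv (x * y) ≡ inv x * inv y
    byCases (yes x≡0) _ = begin
      inv (x * y)     ≡⟨ cong inv (trans (cong (_* y) x≡0) (ℚ.*-zeroˡ y)) ⟩
      0ℚ              ≡⟨ ℚ.*-zeroˡ (inv y) ⟨
      0ℚ * inv y      ≡⟨ cong (λ z → inv z * inv y) x≡0 ⟨
      inv x * inv y   ∎
    byCases (no _) (yes y≡0) = begin
      inv (x * y)     ≡⟨ cong inv (trans (cong (x *_) y≡0) (ℚ.*-zeroʳ x)) ⟩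
      0ℚ              ≡⟨ ℚ.*-zeroʳ (inv x) ⟨
      inv x * 0ℚ      ≡⟨ cong (λ z → inv x * inv z) y≡0 ⟨
      inv x * inv y   ∎
    byCases (no x≢0) (no y≢0) = inv-unique {x * y} (begin
      (x * y) * (inv x * inv y) ≡⟨ regroup x y (inv x) (inv y) ⟩
      (x * inv x) * (y * inv y) ≡⟨ cong₂ _*_ (*-inv x≢0) (*-inv y≢0) ⟩
      1ℚ                        ∎)

  ÷'-*-interchange : ∀ a b c d → (a * b) ÷' (c * d) ≡ (a ÷' c) * (b ÷' d)
  ÷'-*-interchange a b c d = trans (cong ((a * b) *_) (inv-* c d)) (regroup a b (inv c) (inv d))
    where
    regroup : ∀ a b x y → (a * b) * (x * y) ≡ (a * x) * (b * y)
    regroup = solve-∀ ℚ-ring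

  inv-^ℕ : ∀ x n → inv (x ^ℕ n) ≡ inv x ^ℕ n
  inv-^ℕ x zero    = refl
  inv-^ℕ x (suc n) = trans (inv-* x (x ^ℕ n)) (cong (inv x *_) (inv-^ℕ x n))

  ^ℕ-÷' : ∀ {q} → q ≢ 0ℚ → ∀ a b → (q ^ℕ a) ÷' (q ^ℕ b) ≡ q ^ℤ (a ⊖ b)
  ^ℕ-÷' {q} q≢0 a zero = trans (ℚ.*-identityʳ (q ^ℕ a)) (cong (q ^ℤ_) (sym (ℤ.⊖-≥ {a} ℕ.z≤n)))
  ^ℕ-÷' {q} q≢0 zero (suc b) = begin
    1ℚ * inv (q ^ℕ suc b)  ≡⟨ ℚ.*-identityˡ _ ⟩
    inv (q ^ℕ suc b)       ≡⟨ inv-^ℕ q (suc b) ⟩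
    inv q ^ℕ suc b         ≡⟨ cong (q ^ℤ_) (ℤ.⊖-< {0} {suc b} z<s) ⟨
    q ^ℤ (0 ⊖ suc b)       ∎
    where open ≡-Reasoning
  ^ℕ-÷' {q} q≢0 (suc a) (suc b) = begin
    (q * q ^ℕ a) ÷' (q * q ^ℕ b)         ≡⟨ ÷'-*-interchange q (q ^ℕ a) q (q ^ℕ b) ⟩
    (q * inv q) * ((q ^ℕ a) ÷' (q ^ℕ b)) ≡⟨ cong₂ _*_ (*-inv q≢0) (^ℕ-÷' q≢0 a b) ⟩
    1ℚ * q ^ℤ (a ⊖ b)                    ≡⟨ ℚ.*-identityˡ _ ⟩
    q ^ℤ (a ⊖ b)                         ≡⟨ cong (q ^ℤ_) (ℤ.[1+m]⊖[1+n]≡m⊖n a b) ⟨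
    q ^ℤ (suc a ⊖ suc b)                 ∎
    where open ≡-Reasoning

open import Data.Integer using (+_; _-_; _+_; _⊖_)
import Data.Integer.Properties as ℤ
open import Data.Integer.Tactic.RingSolver using (solve-∀)
open import Data.Nat as ℕ using (ℕ; suc; _≥_; _∸_)
open import Data.Rational using (ℚ; 0ℚ; 1ℚ; _<_; _*_)
import Data.Rational.Properties as ℚ
open import Function using (_∘_)
open import Relation.Binary.PropositionalEquality
  using (_≡_; _≢_; refl; sym; trans; cong; cong₂; module ≡-Reasoning)
open HyperbinaryFences using (hq-rgf; *-inv; ÷'-*-interchange; ^ℕ-÷')

exponent-⊖ : ∀ a b c d → ((+ a - + b) + + c) - + d ≡ (a ℕ.+ c) ⊖ (b ℕ.+ d)
exponent-⊖ a b c d = trans (regroup (+ a) (+ b) (+ c) (+ d)) (ℤ.m-n≡m⊖n (a ℕ.+ c) (b ℕ.+ d))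
  where
  regroup : ∀ A B C D → ((A - B) + C) - D ≡ (A + C) - (B + D)
  regroup = solve-∀

corollary3p18 : (n : ℕ) → n ≥ 1 →
    (r′ r s′ s : ℕ) →
    fenceSize (n ∸ 1) ≡ r′ → fenceSize n ≡ r →
    ones (β (n ∸ 1)) ≡ s′ → ones (β n) ≡ s →
    (q : ℚ) → 0ℚ < q →
    CW q n ≡ (q ^ℤ (((+ r′ - + r) + + s′) - + s))
               * (rgf (n ∸ 1) (inv q) ÷' rgf n (inv q))
corollary3p18 (suc n) _ _ _ _ _ refl refl refl refl q 0<q = begin
  hq q n ÷' hq q (suc n)
    ≡⟨ cong₂ _÷'_ (hq-rgf qt n) (hq-rgf qt (suc n)) ⟩
  (q ^ℕ (ρ′ ℕ.+ s′) * rgf n t) ÷' (q ^ℕ (ρ ℕ.+ s) * rgf (suc n) t)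
    ≡⟨ ÷'-*-interchange (q ^ℕ (ρ′ ℕ.+ s′)) (rgf n t) (q ^ℕ (ρ ℕ.+ s)) (rgf (suc n) t) ⟩
  ((q ^ℕ (ρ′ ℕ.+ s′)) ÷' (q ^ℕ (ρ ℕ.+ s))) * (rgf n t ÷' rgf (suc n) t)
    ≡⟨ cong (_* (rgf n t ÷' rgf (suc n) t)) (^ℕ-÷' q≢0 (ρ′ ℕ.+ s′) (ρ ℕ.+ s)) ⟩
  q ^ℤ ((ρ′ ℕ.+ s′) ⊖ (ρ ℕ.+ s)) * (rgf n t ÷' rgf (suc n) t)
    ≡⟨ cong (λ e → q ^ℤ e * (rgf n t ÷' rgf (suc n) t)) (exponent-⊖ ρ′ ρ s′ s) ⟨
  q ^ℤ (((+ ρ′ - + ρ) + + s′) - + s) * (rgf n t ÷' rgf (suc n) t) ∎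
  where
  open ≡-Reasoning
  t : ℚ
  t = inv q
  ρ′ ρ s′ s : ℕ
  ρ′ = fenceSize n
  ρ  = fenceSize (suc n)
  s′ = ones (β n)
  s  = ones (β (suc n))
  q≢0 : q ≢ 0ℚ
  q≢0 = ℚ.<⇒≢ 0<q ∘ sym
  qt : q * t ≡ 1ℚ
  qt = *-inv q≢0
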